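{- Let $G=(V,E)$ be an undirected graph with positive integer edge weights $w$, terminal set $T\subseteq V$, and perturbed weights $\widetilde w$ (as defined in the context). Let $\widetilde{\mathcal L}$ be a laminar family of Steiner cuts that contains every supreme set of $G$ with respect to $\widetilde w$, represented as a forest. Apply to this forest the first and then the second post-order traversal described in the context. Then the resulting laminar forest represents exactly the family of all supreme sets of $G$ with respect to $\widetilde{w}$.
   Context: Perturbation: with $m=|E|$, $N$ an integer larger than the sum of edge weights, $\widetilde w(u,v)=mN\,w(u,v)+r(u,v)$ with $r(u,v)\in\{1,\dots,N\}$. $\widetilde d(X)$ is the total $\widetilde w$-weight of edges with exactly one endpoint in $X$. A Steiner cut is $X\subseteq V$ with $X\cap T\neq\emptyset$, $T\not\subseteq X$; it is extreme (w.r.t. $\widetilde w$) if every Steiner cut $Y\subsetneq X$ has $\widetilde d(Y)>\widetilde d(X)$. For $R\subseteq T$, the supreme set $\widetilde\mu(R)$ is the union of all $\widetilde w$-extreme sets $X$ with $X\cap T=R$ (defined only if some exists). A laminar family is represented as a forest in which the parent of a set is the minimal set of the family properly containing it. Removing a node $R$ means: its children become children of its parent if it has one, and become roots otherwise. First traversal: visit nodes in post-order; when visiting a (still present) node $R$, if some current child $W$ has $\widetilde d(W)\le\widetilde d(R)$, remove $R$. Second traversal: visit nodes in post-order; when visiting $R$, if $R$ has a parent $W$ with $|W\cap T|=|R\cap T|$, remove $R$. -}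

module Defs where

open import Data.Nat using (ℕ; zero; suc; _+_; _*_; _≤_; _<_; _≤ᵇ_; _≡ᵇ_)
open import Data.Fin using (Fin; zero; suc; toℕ)
open import Data.Fin.Subset using (Subset; _⊆_; _⊂_; _∩_; ∣_∣; Nonempty)
  renaming (_∈_ to _∈ₛ_)
open import Data.Vec using (lookup)
open import Data.Bool using (Bool; true; false; if_then_else_; _∧_; not)
open import Data.List using (List; []; _∷_; _++_)
open import Data.Bool.ListAction using (any)
open import Data.Unit using (⊤)
open import Data.List.Membership.Propositional using () renaming (_∈_ to _∈ₗ_)
open import Data.List.Relation.Unary.All using (All)
open import Data.List.Relation.Unary.Unique.Propositional using (Unique)
open import Data.Maybe using (Maybe; just; nothing)
open import Data.Product using (_×_; ∃; ∃-syntax; Σ-syntax)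
open import Data.Sum using (_⊎_)
open import Data.Empty using (⊥)
open import Relation.Nullary using (¬_)
open import Relation.Binary.PropositionalEquality using (_≡_)
open import Function using (_∘_)

∑ : ∀ {n} → (Fin n → ℕ) → ℕ
∑ {zero}  f = 0
∑ {suc n} f = f zero + ∑ (f ∘ suc)

perturb : ℕ → ℕ → ℕ → ℕ
perturb k zero    r = 0
perturb k (suc x) r = k * suc x + r

-- An undirected simple graph on vertex set Fin n with positive integer
-- edge weights (given as a symmetric weight matrix: {u,v} is an edge iff
-- w u v > 0, and then w u v is its weight), a terminal set T, and the
-- perturbation data N, r as in the paper.

record PerturbedGraph (n : ℕ) : Set where
  field
    w      : Fin n → Fin n → ℕ
    w-sym  : ∀ u v → w u v ≡ w v u
    w-loop : ∀ u → w u u ≡ 0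
    T      : Subset n

  -- ordered-pair indicator u < v, used to count each undirected edge once
  lt : Fin n → Fin n → Bool
  lt u v = suc (toℕ u) ≤ᵇ toℕ v

  m : ℕ
  m = ∑ λ u → ∑ λ v → if lt u v ∧ not (w u v ≡ᵇ 0) then 1 else 0

  totalWeight : ℕ
  totalWeight = ∑ λ u → ∑ λ v → if lt u v then w u v else 0

  field
    N       : ℕ
    N-large : totalWeight < N
    r       : Fin n → Fin n → ℕ
    r-sym   : ∀ u v → r u v ≡ r v u
    r-range : ∀ u v → 0 < w u v → 1 ≤ r u v × r u v ≤ N

  w~ : Fin n → Fin n → ℕ
  w~ u v = perturb (m * N) (w u v) (r u v)

  d~ : Subset n → ℕ
  d~ X = ∑ λ u → ∑ λ v → if lookup X u ∧ not (lookup X v) then w~ u v else 0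

  SteinerCut : Subset n → Set
  SteinerCut X = Nonempty (X ∩ T) × ¬ (T ⊆ X)

  Extreme : Subset n → Set
  Extreme X = SteinerCut X × (∀ Y → SteinerCut Y → Y ⊂ X → d~ X < d~ Y)

  -- S is the supreme set μ~(R) for some R ⊆ T for which it is defined:
  -- some extreme X has X ∩ T = R, and S is the union of all extreme X
  -- with X ∩ T = R.
  Supreme : Subset n → Set
  Supreme S = ∃[ R ] (R ⊆ T
                × (∃[ X ] (Extreme X × X ∩ T ≡ R))
                × (∀ v → (v ∈ₛ S → ∃[ X ] (Extreme X × X ∩ T ≡ R × v ∈ₛ X))
                       × (∃[ X ] (Extreme X × X ∩ T ≡ R × v ∈ₛ X) → v ∈ₛ S)))

data Tree (A : Set) : Set where
  node : A → List (Tree A) → Tree A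

Forest : Set → Set
Forest A = List (Tree A)

root : ∀ {A} → Tree A → A
root (node a _) = a

mutual
  nodesT : ∀ {A} → Tree A → List A
  nodesT (node a cs) = a ∷ nodesF cs

  nodesF : ∀ {A} → Forest A → List A
  nodesF []       = []
  nodesF (t ∷ ts) = nodesT t ++ nodesF ts

module _ {n : ℕ} where

  Laminar : List (Subset n) → Set
  Laminar L = ∀ X Y → X ∈ₗ L → Y ∈ₗ L →
              X ⊆ Y ⊎ Y ⊆ X ⊎ (∀ v → v ∈ₛ X → v ∈ₛ Y → ⊥)

  -- the parent (nothing = root) of X is the minimal set of L properly
  -- containing X
  ParentOK : List (Subset n) → Maybe (Subset n) → Subset n → Set
  ParentOK L nothing  X = ∀ Y → Y ∈ₗ L → ¬ (X ⊂ Y)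
  ParentOK L (just P) X = P ∈ₗ L × X ⊂ P × (∀ Y → Y ∈ₗ L → X ⊂ Y → ¬ (Y ⊂ P))

  mutual
    HasseT : List (Subset n) → Maybe (Subset n) → Tree (Subset n) → Set
    HasseT L p (node X cs) = ParentOK L p X × HasseF L (just X) cs

    HasseF : List (Subset n) → Maybe (Subset n) → Forest (Subset n) → Set
    HasseF L p []       = ⊤
    HasseF L p (t ∷ ts) = HasseT L p t × HasseF L p ts

  RepresentsLaminar : Forest (Subset n) → Set
  RepresentsLaminar F = Unique (nodesF F) × Laminar (nodesF F) × HasseF (nodesF F) nothing F

-- Children are processed (recursively)
-- before their parent; removing a node R returns its (processed)
-- children in its place, so they become children of R's parent / roots.

module Traversals {n : ℕ} (G : PerturbedGraph n) where
  open PerturbedGraph G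

  mutual
    trav1T : Tree (Subset n) → Forest (Subset n)
    trav1T (node R cs) = let cs' = trav1F cs in
      if any (λ t → d~ (root t) ≤ᵇ d~ R) cs' then cs' else node R cs' ∷ []

    trav1F : Forest (Subset n) → Forest (Subset n)
    trav1F []       = []
    trav1F (t ∷ ts) = trav1T t ++ trav1F ts

  -- Second traversal: remove R if its parent W has |W ∩ T| = |R ∩ T|.
  -- When R is visited its ancestors have not been visited yet, so its
  -- parent is the one passed down.
  sameT : Maybe (Subset n) → Subset n → Bool
  sameT nothing  R = false
  sameT (just W) R = ∣ W ∩ T ∣ ≡ᵇ ∣ R ∩ T ∣

  mutual
    trav2T : Maybe (Subset n) → Tree (Subset n) → Forest (Subset n)
    trav2T p (node R cs) = let cs' = trav2F (just R) cs in
      if sameT p R then cs' else node R cs' ∷ []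

    trav2F : Maybe (Subset n) → Forest (Subset n) → Forest (Subset n)
    trav2F p []       = []
    trav2F p (t ∷ ts) = trav2T p t ++ trav2F p ts

  process : Forest (Subset n) → Forest (Subset n)
  process F = trav2F nothing (trav1F F)

-- Both traversals prune the forest: the first keeps exactly the members R whose cut is strictly smaller
-- than that of every member properly contained in R (a removed node always leaves a surviving root of no
-- larger cut in its place), the second keeps exactly the survivors whose parent has more terminals.
-- Pruning preserves being the Hasse forest of a laminar family.  By uncrossing, a supreme set S is the
-- only Steiner cut of minimum cut inside S, hence extreme, so it survives the first traversal; and a
-- supreme set is determined by its terminals.  Conversely a survivor R of the first traversal contains an
-- extreme set Z, and laminarity with the minimality of R puts R inside the supreme set of Z, with the same
-- terminals.  Hence a survivor that is not supreme has a parent with the same terminals and is removed by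
-- the second traversal, while a supreme set never has such a parent.

module Submission where

open import Defs
open import Data.Nat using (ℕ; zero; suc; _+_; _≤_; _<_; z≤n; _<?_; _≤?_; _≤ᵇ_; _≡ᵇ_)
open import Data.Nat.Properties
  using ( ≤-refl; ≤-reflexive; ≤-trans; <⇒≤; <⇒≱; ≮⇒≥; ≰⇒>; <-irrefl; <-≤-trans
        ; +-mono-≤; +-monoʳ-≤; +-cancelʳ-≤; +-identityʳ; +-commutativeSemigroup
        ; ≤ᵇ⇒≤; ≤⇒≤ᵇ; ≡ᵇ⇒≡; ≡⇒≡ᵇ; module ≤-Reasoning )
open import Algebra.Properties.CommutativeSemigroup +-commutativeSemigroup using (interchange)
open import Data.Nat.Induction using (<-wellFounded)
open import Induction.WellFounded using (Acc; acc)
open import Data.Fin using (Fin; zero; suc)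
import Data.Fin.Properties as Fin
open import Data.Fin.Subset using (Subset; _∈_; _⊆_; _⊂_; _∩_; _∪_; ∣_∣; Nonempty)
open import Data.Fin.Subset.Properties
  using ( _∈?_; _⊆?_; _⊂?_; nonempty?; anySubset?; ⊆-refl; ⊆-reflexive; ⊆-trans; ⊆-antisym; ⊂-trans
        ; p⊂q⇒p⊆q; p⊂q⇒∣p∣<∣q∣; x∈p∩q⁺; x∈p∩q⁻; x∈p∪q⁻; p∩q⊆p; p∩q⊆q; q⊆p∪q )
open import Data.Vec using (lookup; tabulate)
open import Data.Vec.Properties using (lookup-zipWith; lookup∘tabulate; []=⇒lookup; lookup⇒[]=; ≡-dec)
open import Data.Bool using (Bool; true; false; if_then_else_; _∧_; _∨_; not)
import Data.Bool as Bool
import Data.Bool.Properties as Bool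
open import Data.Bool.ListAction using (any)
open import Data.Unit using (tt)
open import Data.List using (List; []; _∷_; _++_)
import Data.List.Properties as List
open import Data.List.Membership.Propositional using (find; lose) renaming (_∈_ to _∈ₗ_; _∉_ to _∉ₗ_)
open import Data.List.Membership.Propositional.Properties using (∈-++⁺ˡ; ∈-++⁺ʳ; ∈-++⁻)
open import Data.List.Relation.Unary.Any using (here; there)
open import Data.List.Relation.Unary.Any.Properties using (any⁺; any⁻)
open import Data.List.Relation.Unary.All as All using (All; _∷_)
open import Data.List.Relation.Unary.All.Properties using (¬Any⇒All¬; All¬⇒¬Any)
open import Data.List.Relation.Unary.Unique.Propositional using (Unique; []; _∷_)
open import Data.List.Relation.Unary.Unique.Propositional.Properties using (++⁺)
open import Data.List.Relation.Binary.Disjoint.Propositional using (Disjoint)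
open import Data.Maybe using (Maybe; just; nothing)
open import Data.Product using (_×_; _,_; proj₁; proj₂; ∃-syntax)
open import Data.Sum using (_⊎_; inj₁; inj₂; [_,_]′)
open import Data.Empty using (⊥; ⊥-elim)
open import Relation.Nullary using (¬_; Dec; yes; no)
open import Relation.Nullary.Decidable using (_×-dec_; ¬?; isYes; toWitness; fromWitness)
open import Relation.Unary using (Decidable)
open import Relation.Binary.PropositionalEquality using (_≡_; refl; sym; trans; cong; subst)
open import Function using (_∘_; id)
open import Function.Bundles using (_⇔_; mk⇔; Equivalence)

-- Cut functions are submodular

∑-+-mono-≤ : ∀ {m} (f g h k : Fin m → ℕ) → (∀ i → f i + g i ≤ h i + k i) →
             ∑ f + ∑ g ≤ ∑ h + ∑ k
∑-+-mono-≤ {zero}  f g h k le = ≤-refl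
∑-+-mono-≤ {suc m} f g h k le = begin
  (f zero + ∑ (f ∘ suc)) + (g zero + ∑ (g ∘ suc))  ≡⟨ interchange (f zero) _ (g zero) _ ⟩
  (f zero + g zero) + (∑ (f ∘ suc) + ∑ (g ∘ suc))
    ≤⟨ +-mono-≤ (le zero) (∑-+-mono-≤ _ _ _ _ (le ∘ suc)) ⟩
  (h zero + k zero) + (∑ (h ∘ suc) + ∑ (k ∘ suc))  ≡⟨ interchange (h zero) (k zero) _ _ ⟩
  (h zero + ∑ (h ∘ suc)) + (k zero + ∑ (k ∘ suc))  ∎
  where open ≤-Reasoning

leaving : ∀ {n} → Subset n → Fin n → Fin n → ℕ → ℕ
leaving X u v a = if lookup X u ∧ not (lookup X v) then a else 0

cut : ∀ {n} → (Fin n → Fin n → ℕ) → Subset n → ℕ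
cut c X = ∑ λ u → ∑ λ v → leaving X u v (c u v)

leaving-submodular : (a : ℕ) (xu xv yu yv : Bool) →
  (if (xu ∧ yu) ∧ not (xv ∧ yv) then a else 0) + (if (xu ∨ yu) ∧ not (xv ∨ yv) then a else 0)
  ≤ (if xu ∧ not xv then a else 0) + (if yu ∧ not yv then a else 0)
leaving-submodular a true  true  true  false = ≤-reflexive (+-identityʳ a)
leaving-submodular a true  false false false = ≤-reflexive (sym (+-identityʳ a))
leaving-submodular a true  false false true  = z≤n
leaving-submodular a false true  true  false = z≤n
leaving-submodular a true  true  true  true  = ≤-refl
leaving-submodular a true  true  false _     = ≤-refl
leaving-submodular a true  false true  _     = ≤-refl
leaving-submodular a false false _     _     = ≤-refl
leaving-submodular a false true  false _     = ≤-refl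
leaving-submodular a false true  true  true  = ≤-refl

cut-submodular : ∀ {n} (c : Fin n → Fin n → ℕ) (X Y : Subset n) →
                 cut c (X ∩ Y) + cut c (X ∪ Y) ≤ cut c X + cut c Y
cut-submodular c X Y = ∑-+-mono-≤ _ _ _ _ λ u → ∑-+-mono-≤ _ _ _ _ λ v → pointwise u v
  where
  pointwise : ∀ u v → leaving (X ∩ Y) u v (c u v) + leaving (X ∪ Y) u v (c u v)
                      ≤ leaving X u v (c u v) + leaving Y u v (c u v)
  pointwise u v rewrite lookup-zipWith _∧_ u X Y | lookup-zipWith _∧_ v X Y
                      | lookup-zipWith _∨_ u X Y | lookup-zipWith _∨_ v X Y
    = leaving-submodular (c u v) (lookup X u) (lookup X v) (lookup Y u) (lookup Y v)

d~-submodular : ∀ {n} (G : PerturbedGraph n) → let open PerturbedGraph G in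
                ∀ X Y → d~ (X ∩ Y) + d~ (X ∪ Y) ≤ d~ X + d~ Y
d~-submodular G = cut-submodular (PerturbedGraph.w~ G)

module _ {n : ℕ} where

  ⊆⇒⊂⊎≡ : {X Y : Subset n} → X ⊆ Y → X ⊂ Y ⊎ X ≡ Y
  ⊆⇒⊂⊎≡ {X} {Y} X⊆Y with Fin.any? (λ x → (x ∈? Y) ×-dec ¬? (x ∈? X))
  ... | yes new = inj₁ (X⊆Y , new)
  ... | no ¬new = inj₂ (⊆-antisym X⊆Y Y⊆X)
    where
    Y⊆X : Y ⊆ X
    Y⊆X {x} x∈Y with x ∈? X
    ... | yes x∈X = x∈X
    ... | no x∉X = ⊥-elim (¬new (x , x∈Y , x∉X))

  p⊂q⇒q⊈p : {X Y : Subset n} → X ⊂ Y → ¬ (Y ⊆ X)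
  p⊂q⇒q⊈p (_ , x , x∈Y , x∉X) Y⊆X = x∉X (Y⊆X x∈Y)

  ⊆∧∣p∣≡∣q∣⇒≡ : {X Y : Subset n} → X ⊆ Y → ∣ X ∣ ≡ ∣ Y ∣ → X ≡ Y
  ⊆∧∣p∣≡∣q∣⇒≡ X⊆Y ∣X∣≡∣Y∣ with ⊆⇒⊂⊎≡ X⊆Y
  ... | inj₁ X⊂Y = ⊥-elim (<-irrefl ∣X∣≡∣Y∣ (p⊂q⇒∣p∣<∣q∣ X⊂Y))
  ... | inj₂ X≡Y = X≡Y

  ∩-monoˡ-⊆ : {X Y : Subset n} (Z : Subset n) → X ⊆ Y → X ∩ Z ⊆ Y ∩ Z
  ∩-monoˡ-⊆ {X} Z X⊆Y x∈X∩Z with x∈p∩q⁻ X Z x∈X∩Z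
  ... | x∈X , x∈Z = x∈p∩q⁺ (X⊆Y x∈X , x∈Z)

  ∩-sandwich : {A B C : Subset n} (Z : Subset n) → A ⊆ B → B ⊆ C → A ∩ Z ≡ C ∩ Z → B ∩ Z ≡ C ∩ Z
  ∩-sandwich Z A⊆B B⊆C A∩Z≡C∩Z =
    ⊆-antisym (∩-monoˡ-⊆ Z B⊆C) (λ x∈C∩Z → ∩-monoˡ-⊆ Z A⊆B (subst (_ ∈_) (sym A∩Z≡C∩Z) x∈C∩Z))

  Nonempty-∩⁻ˡ : {X Y : Subset n} → Nonempty (X ∩ Y) → Nonempty X
  Nonempty-∩⁻ˡ {X} {Y} (x , x∈X∩Y) = x , proj₁ (x∈p∩q⁻ X Y x∈X∩Y)

  argmin : {P : Subset n → Set} → Decidable P → (f : Subset n → ℕ) →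
           ∀ {W} → P W → ∃[ Z ] (P Z × (∀ Y → P Y → f Z ≤ f Y))
  argmin {P} P? f {W} pW = descend W (<-wellFounded (f W)) pW
    where
    descend : ∀ W → Acc _<_ (f W) → P W → ∃[ Z ] (P Z × (∀ Y → P Y → f Z ≤ f Y))
    descend W (acc smaller) pW with anySubset? (λ Y → P? Y ×-dec (f Y <? f W))
    ... | yes (Y , pY , fY<fW) = descend Y (smaller fY<fW) pY
    ... | no none = W , pW , λ Y pY → ≮⇒≥ (λ fY<fW → none (Y , pY , fY<fW))

-- Extreme and supreme sets of a submodular set function

-- For d = d~ these notions coincide definitionally with those of PerturbedGraph.
module SteinerCuts {n : ℕ} (T : Subset n) (d : Subset n → ℕ)
  (d-submodular : ∀ X Y → d (X ∩ Y) + d (X ∪ Y) ≤ d X + d Y) where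

  SteinerCut : Subset n → Set
  SteinerCut X = Nonempty (X ∩ T) × ¬ (T ⊆ X)

  Extreme : Subset n → Set
  Extreme X = SteinerCut X × (∀ Y → SteinerCut Y → Y ⊂ X → d X < d Y)

  ExtremeCover : Subset n → Fin n → Set
  ExtremeCover R v = ∃[ X ] (Extreme X × X ∩ T ≡ R × v ∈ X)

  Supreme : Subset n → Set
  Supreme S = ∃[ R ] (R ⊆ T
                × (∃[ X ] (Extreme X × X ∩ T ≡ R))
                × (∀ v → (v ∈ S → ExtremeCover R v) × (ExtremeCover R v → v ∈ S)))

  steinerCut? : Decidable SteinerCut
  steinerCut? X = nonempty? (X ∩ T) ×-dec ¬? (T ⊆? X)

  extreme? : Decidable Extreme
  extreme? X with steinerCut? X
  ... | no ¬cut = no (¬cut ∘ proj₁)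
  ... | yes cut with anySubset? (λ Y → steinerCut? Y ×-dec (Y ⊂? X) ×-dec ¬? (d X <? d Y))
  ...   | yes (Y , cutY , Y⊂X , ¬lt) = no (λ ext → ¬lt (proj₂ ext Y cutY Y⊂X))
  ...   | no none = yes (cut , smaller)
    where
    smaller : ∀ Y → SteinerCut Y → Y ⊂ X → d X < d Y
    smaller Y cutY Y⊂X with d X <? d Y
    ... | yes lt = lt
    ... | no ¬lt = ⊥-elim (none (Y , cutY , Y⊂X , ¬lt))

  extreme-⊆ : ∀ {W} → SteinerCut W → ∃[ Z ] (Extreme Z × Z ⊆ W × d Z ≤ d W)
  extreme-⊆ {W} cutW
    with argmin (λ Y → steinerCut? Y ×-dec (Y ⊆? W) ×-dec (d Y ≤? d W)) ∣_∣ (cutW , ⊆-refl , ≤-refl)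
  ... | Z , (cutZ , Z⊆W , dZ≤dW) , least = Z , (cutZ , smaller) , Z⊆W , dZ≤dW
    where
    smaller : ∀ Y → SteinerCut Y → Y ⊂ Z → d Z < d Y
    smaller Y cutY Y⊂Z with d Z <? d Y
    ... | yes lt = lt
    ... | no ¬lt = ⊥-elim (<⇒≱ (p⊂q⇒∣p∣<∣q∣ Y⊂Z)
                     (least Y (cutY , ⊆-trans (p⊂q⇒p⊆q Y⊂Z) Z⊆W , ≤-trans (≮⇒≥ ¬lt) dZ≤dW)))

  extremeCover? : ∀ R v → Dec (ExtremeCover R v)
  extremeCover? R v = anySubset? (λ X → extreme? X ×-dec ≡-dec Bool._≟_ (X ∩ T) R ×-dec (v ∈? X))

  μ : Subset n → Subset n
  μ R = tabulate λ v → isYes (extremeCover? R v)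

  ∈μ⁻ : ∀ {R v} → v ∈ μ R → ExtremeCover R v
  ∈μ⁻ {R} {v} v∈μR = toWitness {a? = extremeCover? R v}
    (Equivalence.from Bool.T-≡ (trans (sym (lookup∘tabulate _ v)) ([]=⇒lookup v∈μR)))

  ∈μ⁺ : ∀ {R v} → ExtremeCover R v → v ∈ μ R
  ∈μ⁺ {R} {v} cover =
    lookup⇒[]= v (μ R) (trans (lookup∘tabulate _ v) (Equivalence.to Bool.T-≡ (fromWitness cover)))

  μ-supreme : ∀ {X} → Extreme X → Supreme (μ (X ∩ T))
  μ-supreme {X} ext = X ∩ T , p∩q⊆q X T , (X , ext , refl) , λ v → ∈μ⁻ , ∈μ⁺

  extreme-⊆-μ : ∀ {X} → Extreme X → X ⊆ μ (X ∩ T)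
  extreme-⊆-μ ext v∈X = ∈μ⁺ (_ , ext , refl , v∈X)

  extreme-uncross : ∀ {X Z} → Extreme X → Nonempty ((X ∩ Z) ∩ T) → d Z ≤ d (X ∪ Z) → X ⊆ Z
  extreme-uncross {X} {Z} (cutX , smaller) meet dZ≤dX∪Z with ⊆⇒⊂⊎≡ (p∩q⊆p X Z)
  ... | inj₁ X∩Z⊂X = ⊥-elim (<⇒≱ (smaller (X ∩ Z) cutX∩Z X∩Z⊂X) dX∩Z≤dX)
    where
    cutX∩Z : SteinerCut (X ∩ Z)
    cutX∩Z = meet , λ T⊆X∩Z → proj₂ cutX (⊆-trans T⊆X∩Z (p∩q⊆p X Z))
    dX∩Z≤dX : d (X ∩ Z) ≤ d X
    dX∩Z≤dX = +-cancelʳ-≤ (d (X ∪ Z)) _ _ (≤-trans (d-submodular X Z) (+-monoʳ-≤ (d X) dZ≤dX∪Z))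
  ... | inj₂ X∩Z≡X = subst (_⊆ Z) X∩Z≡X (p∩q⊆q X Z)

  module _ {S : Subset n} (sup : Supreme S) where

    private
      R = proj₁ sup
      witness = proj₁ (proj₂ (proj₂ sup))
      mem = proj₂ (proj₂ (proj₂ sup))

      R⊆S∩T : R ⊆ S ∩ T
      R⊆S∩T {v} v∈R with witness
      ... | X , ext , refl = x∈p∩q⁺ (proj₂ (mem v) (X , ext , refl , proj₁ v∈X∩T) , proj₂ v∈X∩T)
        where v∈X∩T = x∈p∩q⁻ X T v∈R

      S∩T⊆R : S ∩ T ⊆ R
      S∩T⊆R {v} v∈S∩T with x∈p∩q⁻ S T v∈S∩T
      ... | v∈S , v∈T with proj₁ (mem v) v∈S
      ...   | X , ext , refl , v∈X = x∈p∩q⁺ (v∈X , v∈T)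

    supreme-∩T : S ∩ T ≡ proj₁ sup
    supreme-∩T = ⊆-antisym S∩T⊆R R⊆S∩T

    supreme-witness : ∃[ X ] (Extreme X × X ∩ T ≡ S ∩ T)
    supreme-witness with witness
    ... | X , ext , X∩T≡R = X , ext , trans X∩T≡R (sym supreme-∩T)

    supreme-cover : ∀ {v} → v ∈ S → ∃[ X ] (Extreme X × X ∩ T ≡ S ∩ T × v ∈ X)
    supreme-cover {v} v∈S with proj₁ (mem v) v∈S
    ... | X , ext , X∩T≡R , v∈X = X , ext , trans X∩T≡R (sym supreme-∩T) , v∈X

    extreme-⊆-supreme : ∀ {X} → Extreme X → X ∩ T ≡ S ∩ T → X ⊆ S
    extreme-⊆-supreme {X} ext X∩T≡S∩T {v} v∈X =
      proj₂ (mem v) (X , ext , trans X∩T≡S∩T supreme-∩T , v∈X)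

    supreme-steinerCut : SteinerCut S
    supreme-steinerCut with supreme-witness
    ... | X , (((t , t∈X∩T) , T⊈X) , _) , X∩T≡S∩T = (t , subst (t ∈_) X∩T≡S∩T t∈X∩T) , T⊈S
      where
      T⊈S : ¬ (T ⊆ S)
      T⊈S T⊆S = T⊈X λ v∈T →
        proj₁ (x∈p∩q⁻ X T (subst (_ ∈_) (sym X∩T≡S∩T) (x∈p∩q⁺ (T⊆S v∈T , v∈T))))

    minimal-⊇-supreme : ∀ {Z} → SteinerCut Z → Z ⊆ S →
                        (∀ Y → SteinerCut Y → Y ⊆ S → d Z ≤ d Y) → S ⊆ Z
    minimal-⊇-supreme {Z} ((t , t∈Z∩T) , _) Z⊆S least v∈S with supreme-cover v∈S
    ... | X , ext , X∩T≡S∩T , v∈X = extreme-uncross ext meet (least (X ∪ Z) cutX∪Z X∪Z⊆S) v∈X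
      where
      X∪Z⊆S : X ∪ Z ⊆ S
      X∪Z⊆S w∈X∪Z = [ extreme-⊆-supreme ext X∩T≡S∩T , Z⊆S ]′ (x∈p∪q⁻ X Z w∈X∪Z)
      t∈X∩T : t ∈ X ∩ T
      t∈X∩T = subst (t ∈_) (sym X∩T≡S∩T) (∩-monoˡ-⊆ T Z⊆S t∈Z∩T)
      meet : Nonempty ((X ∩ Z) ∩ T)
      meet = t , x∈p∩q⁺ (x∈p∩q⁺ (proj₁ (x∈p∩q⁻ X T t∈X∩T) , proj₁ (x∈p∩q⁻ Z T t∈Z∩T))
                        , proj₂ (x∈p∩q⁻ Z T t∈Z∩T))
      cutX∪Z : SteinerCut (X ∪ Z)
      cutX∪Z = (t , ∩-monoˡ-⊆ T (q⊆p∪q X Z) t∈Z∩T)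
             , λ T⊆X∪Z → proj₂ supreme-steinerCut (⊆-trans T⊆X∪Z X∪Z⊆S)

    supreme-extreme : Extreme S
    supreme-extreme = supreme-steinerCut , smaller
      where
      S-least : ∀ Y → SteinerCut Y → Y ⊆ S → d S ≤ d Y
      S-least Y cutY Y⊆S with argmin (λ Y → steinerCut? Y ×-dec (Y ⊆? S)) d (supreme-steinerCut , ⊆-refl)
      ... | Z , (cutZ , Z⊆S) , least = subst (λ W → d W ≤ d Y) Z≡S (least Y (cutY , Y⊆S))
        where
        Z≡S : Z ≡ S
        Z≡S = ⊆-antisym Z⊆S (minimal-⊇-supreme cutZ Z⊆S λ Y′ cutY′ Y′⊆S → least Y′ (cutY′ , Y′⊆S))
      smaller : ∀ Y → SteinerCut Y → Y ⊂ S → d S < d Y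
      smaller Y cutY Y⊂S with d S <? d Y
      ... | yes lt = lt
      ... | no ¬lt = ⊥-elim (p⊂q⇒q⊈p Y⊂S (minimal-⊇-supreme cutY (p⊂q⇒p⊆q Y⊂S)
                       λ Y′ cutY′ Y′⊆S → ≤-trans (≮⇒≥ ¬lt) (S-least Y′ cutY′ Y′⊆S)))

  supreme-unique : ∀ {S S′} → Supreme S → Supreme S′ → S ∩ T ≡ S′ ∩ T → S ≡ S′
  supreme-unique sup sup′ S∩T≡S′∩T =
    ⊆-antisym (extreme-⊆-supreme sup′ (supreme-extreme sup) S∩T≡S′∩T)
              (extreme-⊆-supreme sup (supreme-extreme sup′) (sym S∩T≡S′∩T))

  extreme-≤ : ∀ {S Z} → Extreme S → SteinerCut Z → Z ⊆ S → d S ≤ d Z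
  extreme-≤ (_ , smaller) cutZ Z⊆S with ⊆⇒⊂⊎≡ Z⊆S
  ... | inj₁ Z⊂S = <⇒≤ (smaller _ cutZ Z⊂S)
  ... | inj₂ refl = ≤-refl

  ExtremeIn : List (Subset n) → Subset n → Set
  ExtremeIn L X = ∀ Y → Y ∈ₗ L → Y ⊂ X → d X < d Y

  module _ {L : List (Subset n)} (laminar : Laminar L) (cuts : All SteinerCut L)
           (complete : ∀ S → Supreme S → S ∈ₗ L) where

    extreme⇒extremeIn : ∀ {X} → Extreme X → ExtremeIn L X
    extreme⇒extremeIn (_ , smaller) Y Y∈L = smaller Y (All.lookup cuts Y∈L)

    extremeIn-⊆-supreme : ∀ {X} → X ∈ₗ L → ExtremeIn L X →
                          ∃[ S ] (Supreme S × X ⊆ S × X ∩ T ≡ S ∩ T)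
    extremeIn-⊆-supreme {X} X∈L extremeIn with extreme-⊆ (All.lookup cuts X∈L)
    ... | Z , extZ , Z⊆X , dZ≤dX = S , supreme , X⊆S , ∩-sandwich T Z⊆X X⊆S (sym (supreme-∩T supreme))
      where
      S = μ (Z ∩ T)
      supreme : Supreme S
      supreme = μ-supreme extZ
      Z⊆S : Z ⊆ S
      Z⊆S = extreme-⊆-μ extZ
      S⊄X : ¬ (S ⊂ X)
      S⊄X S⊂X = <⇒≱ (extremeIn S (complete S supreme) S⊂X)
                  (≤-trans (extreme-≤ (supreme-extreme supreme) (proj₁ extZ) Z⊆S) dZ≤dX)
      X⊆S : X ⊆ S
      X⊆S with laminar X S X∈L (complete S supreme)
      ... | inj₁ X⊆S = X⊆S
      ... | inj₂ (inj₂ disjoint) =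
        let z , z∈Z = Nonempty-∩⁻ˡ (proj₁ (proj₁ extZ)) in ⊥-elim (disjoint z (Z⊆X z∈Z) (Z⊆S z∈Z))
      ... | inj₂ (inj₁ S⊆X) with ⊆⇒⊂⊎≡ S⊆X
      ...   | inj₁ S⊂X = ⊥-elim (S⊄X S⊂X)
      ...   | inj₂ S≡X = ⊆-reflexive (sym S≡X)

-- Forests: occurrences of nodes and pruning

module _ {A : Set} where

  Unique-∷⁻ : ∀ {x} {xs : List A} → Unique (x ∷ xs) → x ∉ₗ xs × Unique xs
  Unique-∷⁻ (x∉ ∷ u) = All¬⇒¬Any x∉ , u

  Unique-++⁻ : ∀ (xs : List A) {ys} → Unique (xs ++ ys) → Unique xs × Unique ys × Disjoint xs ys
  Unique-++⁻ []       u        = [] , u , λ ()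
  Unique-++⁻ (x ∷ xs) (x∉ ∷ u) with Unique-++⁻ xs u
  ... | uxs , uys , disjoint = ¬Any⇒All¬ xs (All¬⇒¬Any x∉ ∘ ∈-++⁺ˡ) ∷ uxs , uys , disjoint′
    where
    disjoint′ : Disjoint (x ∷ xs) _
    disjoint′ (here refl , v∈ys) = All¬⇒¬Any x∉ (∈-++⁺ʳ xs v∈ys)
    disjoint′ (there v∈xs , v∈ys) = disjoint (v∈xs , v∈ys)

  nodesF-++ : (F G : Forest A) → nodesF (F ++ G) ≡ nodesF F ++ nodesF G
  nodesF-++ []      G = refl
  nodesF-++ (t ∷ F) G rewrite nodesF-++ F G = sym (List.++-assoc (nodesT t) (nodesF F) (nodesF G))

  root-∈ : ∀ {t} {F : Forest A} → t ∈ₗ F → root t ∈ₗ nodesF F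
  root-∈ {node X cs} (here refl) = here refl
  root-∈ {t} {u ∷ F} (there t∈F) = ∈-++⁺ʳ (nodesT u) (root-∈ t∈F)

  data Occurs : Forest A → A → Forest A → Set where
    top    : ∀ {X cs ts} → Occurs (node X cs ∷ ts) X cs
    below  : ∀ {X cs ts Y cy} → Occurs cs Y cy → Occurs (node X cs ∷ ts) Y cy
    beside : ∀ {t ts Y cy} → Occurs ts Y cy → Occurs (t ∷ ts) Y cy

  occurs⇒∈ : ∀ {F X cs} → Occurs F X cs → X ∈ₗ nodesF F
  occurs⇒∈ top = here refl
  occurs⇒∈ (below o) = there (∈-++⁺ˡ (occurs⇒∈ o))
  occurs⇒∈ {t ∷ _} (beside o) = ∈-++⁺ʳ (nodesT t) (occurs⇒∈ o)

  occurs-descendant⇒∈ : ∀ {F X cs Z} → Occurs F X cs → Z ∈ₗ nodesF cs → Z ∈ₗ nodesF F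
  occurs-descendant⇒∈ top Z∈ = there (∈-++⁺ˡ Z∈)
  occurs-descendant⇒∈ (below o) Z∈ = there (∈-++⁺ˡ (occurs-descendant⇒∈ o Z∈))
  occurs-descendant⇒∈ {t ∷ _} (beside o) Z∈ = ∈-++⁺ʳ (nodesT t) (occurs-descendant⇒∈ o Z∈)

  ∈⇒occurs : ∀ {F Z} → Z ∈ₗ nodesF F → ∃[ cs ] Occurs F Z cs
  ∈⇒occurs {node X ch ∷ ts} (here refl) = ch , top
  ∈⇒occurs {node X ch ∷ ts} (there Z∈) with ∈-++⁻ (nodesF ch) Z∈
  ... | inj₁ Z∈ch = let cs , o = ∈⇒occurs Z∈ch in cs , below o
  ... | inj₂ Z∈ts = let cs , o = ∈⇒occurs Z∈ts in cs , beside o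

  tree-∈⇒occurs : ∀ {F Y cy} → node Y cy ∈ₗ F → Occurs F Y cy
  tree-∈⇒occurs (here refl) = top
  tree-∈⇒occurs (there t∈) = beside (tree-∈⇒occurs t∈)

  occurs-trans : ∀ {F X cs Y cy} → Occurs F X cs → Occurs cs Y cy → Occurs F Y cy
  occurs-trans top o = below o
  occurs-trans (below o) o′ = below (occurs-trans o o′)
  occurs-trans (beside o) o′ = beside (occurs-trans o o′)

  occurs-++⁻ : ∀ F {G X cs} → Occurs (F ++ G) X cs → Occurs F X cs ⊎ Occurs G X cs
  occurs-++⁻ [] o = inj₂ o
  occurs-++⁻ (t ∷ F) top = inj₁ top
  occurs-++⁻ (t ∷ F) (below o) = inj₁ (below o)
  occurs-++⁻ (t ∷ F) (beside o) with occurs-++⁻ F o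
  ... | inj₁ o′ = inj₁ (beside o′)
  ... | inj₂ o′ = inj₂ o′

  Subforest : Forest A → Forest A → Set
  Subforest G F = ∀ {X cs} → Occurs G X cs → Occurs F X cs

  occurs-singleton : ∀ {t ts X cs} → Occurs (t ∷ []) X cs → Occurs (t ∷ ts) X cs
  occurs-singleton top = top
  occurs-singleton (below o) = below o

  rest-unique : ∀ t ts → Unique (nodesF (t ∷ ts)) → Unique (nodesF ts)
  rest-unique t ts u = proj₁ (proj₂ (Unique-++⁻ (nodesT t) u))

  module _ {X : A} (cs ts : Forest A) (u : Unique (nodesF (node X cs ∷ ts))) where

    private
      split = Unique-++⁻ (nodesF cs) (proj₂ (Unique-∷⁻ u))

    top∉children : X ∉ₗ nodesF cs
    top∉children X∈ = proj₁ (Unique-∷⁻ u) (∈-++⁺ˡ X∈)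

    top∉rest : X ∉ₗ nodesF ts
    top∉rest X∈ = proj₁ (Unique-∷⁻ u) (∈-++⁺ʳ (nodesF cs) X∈)

    children-unique : Unique (nodesF cs)
    children-unique = proj₁ split

    children-rest-disjoint : Disjoint (nodesF cs) (nodesF ts)
    children-rest-disjoint = proj₂ (proj₂ split)

  occurs-unique : ∀ {F X cs cs′} → Unique (nodesF F) → Occurs F X cs → Occurs F X cs′ → cs ≡ cs′
  occurs-unique u top top = refl
  occurs-unique {node _ ch ∷ ts} u top (below o) = ⊥-elim (top∉children ch ts u (occurs⇒∈ o))
  occurs-unique {node _ ch ∷ ts} u top (beside o) = ⊥-elim (top∉rest ch ts u (occurs⇒∈ o))
  occurs-unique {node _ ch ∷ ts} u (below o) top = ⊥-elim (top∉children ch ts u (occurs⇒∈ o))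
  occurs-unique {node _ ch ∷ ts} u (below o) (below o′) = occurs-unique (children-unique ch ts u) o o′
  occurs-unique {node _ ch ∷ ts} u (below o) (beside o′) =
    ⊥-elim (children-rest-disjoint ch ts u (occurs⇒∈ o , occurs⇒∈ o′))
  occurs-unique {node _ ch ∷ ts} u (beside o) top = ⊥-elim (top∉rest ch ts u (occurs⇒∈ o))
  occurs-unique {node _ ch ∷ ts} u (beside o) (below o′) =
    ⊥-elim (children-rest-disjoint ch ts u (occurs⇒∈ o′ , occurs⇒∈ o))
  occurs-unique {t ∷ ts} u (beside o) (beside o′) = occurs-unique (rest-unique t ts u) o o′

  occurs-children-unique : ∀ {F X cs} → Unique (nodesF F) → Occurs F X cs → Unique (nodesF cs)
  occurs-children-unique {node _ ch ∷ ts} u top = children-unique ch ts u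
  occurs-children-unique {node _ ch ∷ ts} u (below o) = occurs-children-unique (children-unique ch ts u) o
  occurs-children-unique {t ∷ ts} u (beside o) = occurs-children-unique (rest-unique t ts u) o

  top-∉-descendants : ∀ {F Y cy W cw} → Unique (nodesF F) → node Y cy ∈ₗ F → Occurs F W cw →
                      Y ∉ₗ nodesF cw
  top-∉-descendants {node _ cy ∷ ts} u (here refl) top Y∈ = top∉children cy ts u Y∈
  top-∉-descendants {node _ cy ∷ ts} u (here refl) (below o) Y∈ =
    top∉children cy ts u (occurs-descendant⇒∈ o Y∈)
  top-∉-descendants {node _ cy ∷ ts} u (here refl) (beside o) Y∈ =
    top∉rest cy ts u (occurs-descendant⇒∈ o Y∈)
  top-∉-descendants {node _ ch ∷ ts} u (there t∈) top Y∈ = children-rest-disjoint ch ts u (Y∈ , root-∈ t∈)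
  top-∉-descendants {node _ ch ∷ ts} u (there t∈) (below o) Y∈ =
    children-rest-disjoint ch ts u (occurs-descendant⇒∈ o Y∈ , root-∈ t∈)
  top-∉-descendants {t ∷ ts} u (there t∈) (beside o) Y∈ = top-∉-descendants (rest-unique t ts u) t∈ o Y∈

module _ {A : Set} (K : A → Set) where

  mutual
    data PrunedT : Tree A → Forest A → Set where
      keep : ∀ {R cs cs′} → K R → PrunedF cs cs′ → PrunedT (node R cs) (node R cs′ ∷ [])
      drop : ∀ {R cs cs′} → ¬ K R → PrunedF cs cs′ → PrunedT (node R cs) cs′

    data PrunedF : Forest A → Forest A → Set where
      []  : PrunedF [] []
      _∷_ : ∀ {t f ts fs} → PrunedT t f → PrunedF ts fs → PrunedF (t ∷ ts) (f ++ fs)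

module _ {A : Set} {K : A → Set} where

  mutual
    prunedT-∈⁻ : ∀ {t f Z} → PrunedT K t f → Z ∈ₗ nodesF f → Z ∈ₗ nodesT t × K Z
    prunedT-∈⁻ (keep KR _) (here refl) = here refl , KR
    prunedT-∈⁻ (keep KR pruned) (there Z∈) =
      let Z∈cs , KZ = pruned-∈⁻ pruned (subst (_ ∈ₗ_) (List.++-identityʳ _) Z∈) in there Z∈cs , KZ
    prunedT-∈⁻ (drop _ pruned) Z∈ = let Z∈cs , KZ = pruned-∈⁻ pruned Z∈ in there Z∈cs , KZ

    pruned-∈⁻ : ∀ {F F′ Z} → PrunedF K F F′ → Z ∈ₗ nodesF F′ → Z ∈ₗ nodesF F × K Z
    pruned-∈⁻ (_∷_ {t} {f} {fs = fs} pruned-t pruned-ts) Z∈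
      with ∈-++⁻ (nodesF f) (subst (_ ∈ₗ_) (nodesF-++ f fs) Z∈)
    ... | inj₁ Z∈f  = let Z∈t , KZ = prunedT-∈⁻ pruned-t Z∈f in ∈-++⁺ˡ Z∈t , KZ
    ... | inj₂ Z∈fs = let Z∈ts , KZ = pruned-∈⁻ pruned-ts Z∈fs in ∈-++⁺ʳ (nodesT t) Z∈ts , KZ

  mutual
    prunedT-∈⁺ : ∀ {t f Z} → PrunedT K t f → Z ∈ₗ nodesT t → K Z → Z ∈ₗ nodesF f
    prunedT-∈⁺ (keep _ _) (here refl) _ = here refl
    prunedT-∈⁺ (keep _ pruned) (there Z∈) KZ = there (∈-++⁺ˡ (pruned-∈⁺ pruned Z∈ KZ))
    prunedT-∈⁺ (drop ¬KR _) (here refl) KZ = ⊥-elim (¬KR KZ)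
    prunedT-∈⁺ (drop _ pruned) (there Z∈) KZ = pruned-∈⁺ pruned Z∈ KZ

    pruned-∈⁺ : ∀ {F F′ Z} → PrunedF K F F′ → Z ∈ₗ nodesF F → K Z → Z ∈ₗ nodesF F′
    pruned-∈⁺ (_∷_ {t} {f} {fs = fs} pruned-t pruned-ts) Z∈ KZ =
      subst (_ ∈ₗ_) (sym (nodesF-++ f fs)) ([ in-t , in-ts ]′ (∈-++⁻ (nodesT t) Z∈))
      where
      in-t = λ Z∈t → ∈-++⁺ˡ (prunedT-∈⁺ pruned-t Z∈t KZ)
      in-ts = λ Z∈ts → ∈-++⁺ʳ (nodesF f) (pruned-∈⁺ pruned-ts Z∈ts KZ)

  mutual
    prunedT-occurs : ∀ {t f X cs′} → PrunedT K t f → Occurs f X cs′ →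
                     ∃[ cs ] (Occurs (t ∷ []) X cs × PrunedF K cs cs′)
    prunedT-occurs (keep _ pruned) top = _ , top , pruned
    prunedT-occurs (keep _ pruned) (below o) = let cs , o′ , p = pruned-occurs pruned o in cs , below o′ , p
    prunedT-occurs (drop _ pruned) o = let cs , o′ , p = pruned-occurs pruned o in cs , below o′ , p

    pruned-occurs : ∀ {F F′ X cs′} → PrunedF K F F′ → Occurs F′ X cs′ →
                    ∃[ cs ] (Occurs F X cs × PrunedF K cs cs′)
    pruned-occurs (_∷_ {f = f} pruned-t pruned-ts) o with occurs-++⁻ f o
    ... | inj₁ o′ = let cs , o″ , p = prunedT-occurs pruned-t o′ in cs , occurs-singleton o″ , p
    ... | inj₂ o′ = let cs , o″ , p = pruned-occurs pruned-ts o′ in cs , beside o″ , p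

  mutual
    prunedT-unique : ∀ {t f} → PrunedT K t f → Unique (nodesT t) → Unique (nodesF f)
    prunedT-unique (keep {R} {cs′ = cs′} _ pruned) (R∉ ∷ u) =
      subst Unique (sym (List.++-identityʳ (R ∷ nodesF cs′)))
        (¬Any⇒All¬ _ (All¬⇒¬Any R∉ ∘ proj₁ ∘ pruned-∈⁻ pruned) ∷ pruned-unique pruned u)
    prunedT-unique (drop _ pruned) (_ ∷ u) = pruned-unique pruned u

    pruned-unique : ∀ {F F′} → PrunedF K F F′ → Unique (nodesF F) → Unique (nodesF F′)
    pruned-unique [] u = []
    pruned-unique (_∷_ {t} {f} {fs = fs} pruned-t pruned-ts) u with Unique-++⁻ (nodesT t) u
    ... | ut , uts , disjoint = subst Unique (sym (nodesF-++ f fs))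
          (++⁺ (prunedT-unique pruned-t ut) (pruned-unique pruned-ts uts)
               λ (Z∈f , Z∈fs) → disjoint (proj₁ (prunedT-∈⁻ pruned-t Z∈f) ,
                                          proj₁ (pruned-∈⁻ pruned-ts Z∈fs)))

-- Hasse forests of laminar families

module _ {n : ℕ} where

  record DescendantsExact (F : Forest (Subset n)) : Set where
    field
      descendant⇒⊂ : ∀ {X cs Z} → Occurs F X cs → Z ∈ₗ nodesF cs → Z ⊂ X
      ⊂⇒descendant : ∀ {X cs Z} → Occurs F X cs → Z ∈ₗ nodesF F → Z ⊂ X → Z ∈ₗ nodesF cs

  open DescendantsExact public

  module _ {L : List (Subset n)} where

    hasse-children-⊂ : ∀ {X cs Z} → HasseF L (just X) cs → Z ∈ₗ nodesF cs → Z ⊂ X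
    hasse-children-⊂ {cs = node Y cy ∷ ts} ((Y-parent , _) , _) (here refl) = proj₁ (proj₂ Y-parent)
    hasse-children-⊂ {cs = node Y cy ∷ ts} ((Y-parent , hasse-cy) , hasse-ts) (there Z∈)
      with ∈-++⁻ (nodesF cy) Z∈
    ... | inj₁ Z∈cy = ⊂-trans (hasse-children-⊂ hasse-cy Z∈cy) (proj₁ (proj₂ Y-parent))
    ... | inj₂ Z∈ts = hasse-children-⊂ hasse-ts Z∈ts

    hasse-occurs : ∀ {p G X cs} → HasseF L p G → Occurs G X cs → HasseF L (just X) cs
    hasse-occurs ((_ , hasse-cs) , _) top = hasse-cs
    hasse-occurs ((_ , hasse-cy) , _) (below o) = hasse-occurs hasse-cy o
    hasse-occurs (_ , hasse-ts) (beside o) = hasse-occurs hasse-ts o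

    hasse-parent : ∀ {p G X} → HasseF L p G → X ∈ₗ nodesF G → ∃[ q ] ParentOK L q X
    hasse-parent {p} {node Y cy ∷ ts} ((Y-parent , _) , _) (here refl) = p , Y-parent
    hasse-parent {p} {node Y cy ∷ ts} ((_ , hasse-cy) , hasse-ts) (there X∈) with ∈-++⁻ (nodesF cy) X∈
    ... | inj₁ X∈cy = hasse-parent hasse-cy X∈cy
    ... | inj₂ X∈ts = hasse-parent hasse-ts X∈ts

    parent-⊆ : ∀ {P X Y} → Laminar L → ParentOK L (just P) X → Nonempty X → Y ∈ₗ L → X ⊂ Y → P ⊆ Y
    parent-⊆ {P} {Y = Y} laminar (P∈ , X⊂P , minimal) (x , x∈X) Y∈ X⊂Y with laminar P Y P∈ Y∈
    ... | inj₁ P⊆Y = P⊆Y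
    ... | inj₂ (inj₂ disjoint) = ⊥-elim (disjoint x (proj₁ X⊂P x∈X) (proj₁ X⊂Y x∈X))
    ... | inj₂ (inj₁ Y⊆P) with ⊆⇒⊂⊎≡ Y⊆P
    ...   | inj₁ Y⊂P = ⊥-elim (minimal Y Y∈ X⊂Y Y⊂P)
    ...   | inj₂ Y≡P = ⊆-reflexive (sym Y≡P)

    ParentBelow : Maybe (Subset n) → Subset n → Set
    ParentBelow p Y = ∃[ P ] (p ≡ just P × P ⊆ Y)

    parent-below : ∀ {p X Y} → Laminar L → ParentOK L p X → Nonempty X → Y ∈ₗ L → X ⊂ Y → ParentBelow p Y
    parent-below {nothing} _ root _ Y∈ X⊂Y = ⊥-elim (root _ Y∈ X⊂Y)
    parent-below {just P} laminar X-parent ne Y∈ X⊂Y = P , refl , parent-⊆ laminar X-parent ne Y∈ X⊂Y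

    parentOK-unique : ∀ {p q X} → Laminar L → ParentOK L p X → ParentOK L q X → Nonempty X → p ≡ q
    parentOK-unique {nothing} {nothing} _ _ _ _ = refl
    parentOK-unique {nothing} {just Q} _ root (Q∈ , X⊂Q , _) _ = ⊥-elim (root Q Q∈ X⊂Q)
    parentOK-unique {just P} {nothing} _ (P∈ , X⊂P , _) root _ = ⊥-elim (root P P∈ X⊂P)
    parentOK-unique {just P} {just Q} laminar P-parent Q-parent ne =
      cong just (⊆-antisym (parent-⊆ laminar P-parent ne (proj₁ Q-parent) (proj₁ (proj₂ Q-parent)))
                           (parent-⊆ laminar Q-parent ne (proj₁ P-parent) (proj₁ (proj₂ P-parent))))

    module _ (laminar : Laminar L) (nonempty : ∀ {W} → W ∈ₗ L → Nonempty W) where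

      superset-is-ancestor : ∀ {p G Z Y} → HasseF L p G → (∀ {W} → W ∈ₗ nodesF G → W ∈ₗ L) →
                             Z ∈ₗ nodesF G → Y ∈ₗ L → Z ⊂ Y →
                             (∃[ cs ] (Occurs G Y cs × Z ∈ₗ nodesF cs)) ⊎ ParentBelow p Y
      superset-is-ancestor {G = node X ch ∷ ts} ((X-parent , _) , _) ⊆L (here refl) Y∈ Z⊂Y =
        inj₂ (parent-below laminar X-parent (nonempty (⊆L (here refl))) Y∈ Z⊂Y)
      superset-is-ancestor {G = node X ch ∷ ts} ((X-parent , hasse-ch) , hasse-ts) ⊆L (there Z∈) Y∈ Z⊂Y
        with ∈-++⁻ (nodesF ch) Z∈
      ... | inj₂ Z∈ts with superset-is-ancestor hasse-ts (⊆L ∘ ∈-++⁺ʳ (X ∷ nodesF ch)) Z∈ts Y∈ Z⊂Y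
      ...   | inj₁ (cs , o , Z∈cs) = inj₁ (cs , beside o , Z∈cs)
      ...   | inj₂ above = inj₂ above
      superset-is-ancestor {G = node X ch ∷ ts} ((X-parent , hasse-ch) , hasse-ts) ⊆L (there Z∈) Y∈ Z⊂Y
          | inj₁ Z∈ch with superset-is-ancestor hasse-ch (⊆L ∘ there ∘ ∈-++⁺ˡ) Z∈ch Y∈ Z⊂Y
      ...   | inj₁ (cs , o , Z∈cs) = inj₁ (cs , below o , Z∈cs)
      ...   | inj₂ (X , refl , X⊆Y) with ⊆⇒⊂⊎≡ X⊆Y
      ...     | inj₂ refl = inj₁ (ch , top , Z∈ch)
      ...     | inj₁ X⊂Y = inj₂ (parent-below laminar X-parent (nonempty (⊆L (here refl))) Y∈ X⊂Y)

  hasse⇒exact : ∀ {F} → Laminar (nodesF F) → (∀ {W} → W ∈ₗ nodesF F → Nonempty W) → Unique (nodesF F) →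
                HasseF (nodesF F) nothing F → DescendantsExact F
  hasse⇒exact {F} laminar nonempty unique hasse = record
    { descendant⇒⊂ = λ o → hasse-children-⊂ (hasse-occurs hasse o)
    ; ⊂⇒descendant = ⊂⇒descendant′
    }
    where
    ⊂⇒descendant′ : ∀ {X cs Z} → Occurs F X cs → Z ∈ₗ nodesF F → Z ⊂ X → Z ∈ₗ nodesF cs
    ⊂⇒descendant′ o Z∈ Z⊂X with superset-is-ancestor laminar nonempty hasse id Z∈ (occurs⇒∈ o) Z⊂X
    ... | inj₁ (_ , o′ , Z∈) = subst (λ cs → _ ∈ₗ nodesF cs) (occurs-unique unique o′ o) Z∈
    ... | inj₂ (_ , () , _)

  module _ {F : Forest (Subset n)} (unique : Unique (nodesF F)) (exact : DescendantsExact F) where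

    ChildrenOf : Maybe (Subset n) → Forest (Subset n) → Set
    ChildrenOf nothing  C = C ≡ F
    ChildrenOf (just X) C = Occurs F X C

    childrenOf-occurs : ∀ p {C Y cy} → ChildrenOf p C → node Y cy ∈ₗ C → Occurs F Y cy
    childrenOf-occurs nothing  refl     Y∈C = tree-∈⇒occurs Y∈C
    childrenOf-occurs (just X) X-occurs Y∈C = occurs-trans X-occurs (tree-∈⇒occurs Y∈C)

    private
      hasse-within : ∀ p C → ChildrenOf p C → ∀ G → (∀ {t} → t ∈ₗ G → t ∈ₗ C) → HasseF (nodesF F) p G
      hasse-within p C C-children [] _ = tt
      hasse-within p C C-children (node Y cy ∷ ts) ⊆C =
        (Y-parent p C-children , hasse-within (just Y) cy Y-occurs cy id)
        , hasse-within p C C-children ts (⊆C ∘ there)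
        where
        Y∈C : node Y cy ∈ₗ C
        Y∈C = ⊆C (here refl)
        Y-occurs : Occurs F Y cy
        Y-occurs = childrenOf-occurs p C-children Y∈C
        Y-parent : ∀ p → ChildrenOf p C → ParentOK (nodesF F) p Y
        Y-parent nothing refl W W∈ Y⊂W with ∈⇒occurs W∈
        ... | _ , W-occurs = top-∉-descendants unique Y∈C W-occurs
                               (⊂⇒descendant exact W-occurs (occurs⇒∈ Y-occurs) Y⊂W)
        Y-parent (just X) X-occurs = occurs⇒∈ X-occurs , descendant⇒⊂ exact X-occurs (root-∈ Y∈C) , minimal
          where
          minimal : ∀ W → W ∈ₗ nodesF F → Y ⊂ W → ¬ (W ⊂ X)
          minimal W W∈ Y⊂W W⊂X with ∈⇒occurs (⊂⇒descendant exact X-occurs W∈ W⊂X)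
          ... | _ , W-occurs = top-∉-descendants (occurs-children-unique unique X-occurs) Y∈C W-occurs
                                 (⊂⇒descendant exact (occurs-trans X-occurs W-occurs) (occurs⇒∈ Y-occurs) Y⊂W)

    exact⇒hasse : HasseF (nodesF F) nothing F
    exact⇒hasse = hasse-within nothing F refl F id

  pruned-exact : ∀ {K F F′} → PrunedF K F F′ → DescendantsExact F → DescendantsExact F′
  pruned-exact {F = F} {F′} pruned exact = record
    { descendant⇒⊂ = descendant⇒⊂′
    ; ⊂⇒descendant = ⊂⇒descendant′
    }
    where
    descendant⇒⊂′ : ∀ {X cs′ Z} → Occurs F′ X cs′ → Z ∈ₗ nodesF cs′ → Z ⊂ X
    descendant⇒⊂′ o Z∈ with pruned-occurs pruned o
    ... | _ , o′ , pruned-cs = descendant⇒⊂ exact o′ (proj₁ (pruned-∈⁻ pruned-cs Z∈))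
    ⊂⇒descendant′ : ∀ {X cs′ Z} → Occurs F′ X cs′ → Z ∈ₗ nodesF F′ → Z ⊂ X → Z ∈ₗ nodesF cs′
    ⊂⇒descendant′ o Z∈ Z⊂X with pruned-occurs pruned o | pruned-∈⁻ pruned Z∈
    ... | _ , o′ , pruned-cs | Z∈F , KZ = pruned-∈⁺ pruned-cs (⊂⇒descendant exact o′ Z∈F Z⊂X) KZ

  pruned-represents : ∀ {K F F′} → PrunedF K F F′ → RepresentsLaminar F →
                      (∀ {W} → W ∈ₗ nodesF F → Nonempty W) → RepresentsLaminar F′
  pruned-represents pruned (unique , laminar , hasse) nonempty =
    unique′ , laminar′ , exact⇒hasse unique′ (pruned-exact pruned (hasse⇒exact laminar nonempty unique hasse))
    where
    unique′ = pruned-unique pruned unique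
    laminar′ : Laminar _
    laminar′ X Y X∈ Y∈ = laminar X Y (proj₁ (pruned-∈⁻ pruned X∈)) (proj₁ (pruned-∈⁻ pruned Y∈))

-- The two traversals

module _ {A : Set} (p : A → Bool) (xs : List A) where

  any≡true⇒∃ : any p xs ≡ true → ∃[ x ] (x ∈ₗ xs × Bool.T (p x))
  any≡true⇒∃ eq = find (any⁻ p xs (Equivalence.from Bool.T-≡ eq))

  any≡false⇒∀ : any p xs ≡ false → ∀ {x} → x ∈ₗ xs → ¬ Bool.T (p x)
  any≡false⇒∀ eq x∈ px = subst Bool.T eq (any⁺ p (lose x∈ px))

module FirstTraversal {n : ℕ} (G : PerturbedGraph n) where

  open PerturbedGraph G using (d~)
  open Traversals G using (trav1T; trav1F)

  cut≤ : Subset n → Tree (Subset n) → Bool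
  cut≤ R t = d~ (root t) ≤ᵇ d~ R

  some-root-≤ : ∀ R ts → any (cut≤ R) ts ≡ true → ∃[ u ] (u ∈ₗ ts × d~ (root u) ≤ d~ R)
  some-root-≤ R ts eq with any≡true⇒∃ (cut≤ R) ts eq
  ... | u , u∈ , u≤R = u , u∈ , ≤ᵇ⇒≤ _ _ u≤R

  all-roots-> : ∀ R ts → any (cut≤ R) ts ≡ false → ∀ {u} → u ∈ₗ ts → d~ R < d~ (root u)
  all-roots-> R ts eq u∈ = ≰⇒> (any≡false⇒∀ (cut≤ R) ts eq u∈ ∘ ≤⇒≤ᵇ)

  mutual
    trav1T-root-below : ∀ t {Z} → Z ∈ₗ nodesT t → ∃[ u ] (u ∈ₗ trav1T t × d~ (root u) ≤ d~ Z)
    trav1T-root-below (node R cs) Z∈ with any (cut≤ R) (trav1F cs) in eq | Z∈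
    ... | true  | here refl = some-root-≤ R (trav1F cs) eq
    ... | false | here refl = _ , here refl , ≤-refl
    ... | true  | there Z∈cs = trav1F-root-below cs Z∈cs
    ... | false | there Z∈cs with trav1F-root-below cs Z∈cs
    ...   | u , u∈ , u≤Z = _ , here refl , <⇒≤ (<-≤-trans (all-roots-> R (trav1F cs) eq u∈) u≤Z)

    trav1F-root-below : ∀ F {Z} → Z ∈ₗ nodesF F → ∃[ u ] (u ∈ₗ trav1F F × d~ (root u) ≤ d~ Z)
    trav1F-root-below (t ∷ ts) Z∈ with ∈-++⁻ (nodesT t) Z∈
    ... | inj₁ Z∈t  = let u , u∈ , u≤Z = trav1T-root-below t Z∈t in u , ∈-++⁺ˡ u∈ , u≤Z
    ... | inj₂ Z∈ts = let u , u∈ , u≤Z = trav1F-root-below ts Z∈ts in u , ∈-++⁺ʳ (trav1T t) u∈ , u≤Z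

  open SteinerCuts (PerturbedGraph.T G) d~ (d~-submodular G) using (ExtremeIn)

  module _ {F : Forest (Subset n)} (exact : DescendantsExact F) where

    mutual
      trav1T-pruned : ∀ t → Subforest (t ∷ []) F → PrunedT (ExtremeIn (nodesF F)) t (trav1T t)
      trav1T-pruned (node R cs) embed with any (cut≤ R) (trav1F cs) in eq
      ... | true = drop ¬extremeIn pruned-cs
        where
        pruned-cs = trav1F-pruned cs (embed ∘ below)
        ¬extremeIn : ¬ ExtremeIn (nodesF F) R
        ¬extremeIn extremeIn with some-root-≤ R (trav1F cs) eq
        ... | u , u∈ , u≤R with pruned-∈⁻ pruned-cs (root-∈ {F = trav1F cs} u∈)
        ...   | u∈cs , _ = <⇒≱ (extremeIn _ (occurs-descendant⇒∈ (embed top) u∈cs)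
                                          (descendant⇒⊂ exact (embed top) u∈cs))
                               u≤R
      ... | false = keep extremeIn (trav1F-pruned cs (embed ∘ below))
        where
        extremeIn : ExtremeIn (nodesF F) R
        extremeIn Y Y∈ Y⊂R with trav1F-root-below cs (⊂⇒descendant exact (embed top) Y∈ Y⊂R)
        ... | u , u∈ , u≤Y = <-≤-trans (all-roots-> R (trav1F cs) eq u∈) u≤Y

      trav1F-pruned : ∀ H → Subforest H F → PrunedF (ExtremeIn (nodesF F)) H (trav1F H)
      trav1F-pruned [] _ = []
      trav1F-pruned (t ∷ ts) embed =
        trav1T-pruned t (embed ∘ occurs-singleton) ∷ trav1F-pruned ts (embed ∘ beside)

    trav1-pruned : PrunedF (ExtremeIn (nodesF F)) F (trav1F F)
    trav1-pruned = trav1F-pruned F id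

≢⇒≡ᵇ≡false : ∀ m n → ¬ m ≡ n → (m ≡ᵇ n) ≡ false
≢⇒≡ᵇ≡false m n m≢n with m ≡ᵇ n in eq
... | true  = ⊥-elim (m≢n (≡ᵇ⇒≡ m n (subst Bool.T (sym eq) _)))
... | false = refl

module SecondTraversal {n : ℕ} (G : PerturbedGraph n) where

  open Traversals G using (sameT; trav2T; trav2F)

  ParentTerminalsDiffer : List (Subset n) → Subset n → Set
  ParentTerminalsDiffer L X = ∃[ p ] (ParentOK L p X × sameT p X ≡ false)

  module _ {L : List (Subset n)} (laminar : Laminar L) where

    mutual
      trav2T-pruned : ∀ p t → HasseT L p t → (∀ {W} → W ∈ₗ nodesT t → Nonempty W) →
                      PrunedT (ParentTerminalsDiffer L) t (trav2T p t)
      trav2T-pruned p (node R cs) (R-parent , hasse-cs) nonempty with sameT p R in eq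
      ... | true = drop ¬differ (trav2F-pruned (just R) cs hasse-cs (nonempty ∘ there))
        where
        ¬differ : ¬ ParentTerminalsDiffer L R
        ¬differ (q , q-parent , differ) with parentOK-unique laminar R-parent q-parent (nonempty (here refl))
        ... | refl with trans (sym eq) differ
        ...   | ()
      ... | false = keep (p , R-parent , eq) (trav2F-pruned (just R) cs hasse-cs (nonempty ∘ there))

      trav2F-pruned : ∀ p H → HasseF L p H → (∀ {W} → W ∈ₗ nodesF H → Nonempty W) →
                      PrunedF (ParentTerminalsDiffer L) H (trav2F p H)
      trav2F-pruned p [] _ _ = []
      trav2F-pruned p (t ∷ ts) (hasse-t , hasse-ts) nonempty =
        trav2T-pruned p t hasse-t (nonempty ∘ ∈-++⁺ˡ)
        ∷ trav2F-pruned p ts hasse-ts (nonempty ∘ ∈-++⁺ʳ (nodesT t))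

module Correctness {n : ℕ} (G : PerturbedGraph n) (F : Forest (Subset n))
  (represents : RepresentsLaminar F) (cuts : All (PerturbedGraph.SteinerCut G) (nodesF F))
  (complete : ∀ S → PerturbedGraph.Supreme G S → S ∈ₗ nodesF F) where

  open PerturbedGraph G using (T; d~)
  open Traversals G using (trav1F; sameT; process)
  open SteinerCuts T d~ (d~-submodular G)
  open FirstTraversal G using (trav1-pruned)
  open SecondTraversal G

  private
    laminar = proj₁ (proj₂ represents)

    nonempty : ∀ {W} → W ∈ₗ nodesF F → Nonempty W
    nonempty W∈ = Nonempty-∩⁻ˡ (proj₁ (All.lookup cuts W∈))

    F₁ = trav1F F
    L₁ = nodesF F₁

    pruned₁ : PrunedF (ExtremeIn (nodesF F)) F F₁
    pruned₁ = trav1-pruned (hasse⇒exact laminar nonempty (proj₁ represents) (proj₂ (proj₂ represents)))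

    represents₁ : RepresentsLaminar F₁
    represents₁ = pruned-represents pruned₁ represents nonempty

    laminar₁ = proj₁ (proj₂ represents₁)
    hasse₁ = proj₂ (proj₂ represents₁)

    nonempty₁ : ∀ {W} → W ∈ₗ L₁ → Nonempty W
    nonempty₁ = nonempty ∘ proj₁ ∘ pruned-∈⁻ pruned₁

    pruned₂ : PrunedF (ParentTerminalsDiffer L₁) F₁ (process F)
    pruned₂ = trav2F-pruned laminar₁ nothing F₁ hasse₁ nonempty₁

    supreme∈L₁ : ∀ {S} → Supreme S → S ∈ₗ L₁
    supreme∈L₁ sup =
      pruned-∈⁺ pruned₁ (complete _ sup) (extreme⇒extremeIn laminar cuts complete (supreme-extreme sup))

  process-represents : RepresentsLaminar (process F)
  process-represents = pruned-represents pruned₂ represents₁ nonempty₁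

  supreme⇒∈process : ∀ S → Supreme S → S ∈ₗ nodesF (process F)
  supreme⇒∈process S sup with hasse-parent hasse₁ (supreme∈L₁ sup)
  ... | p , S-parent = pruned-∈⁺ pruned₂ (supreme∈L₁ sup) (p , S-parent , differs p S-parent)
    where
    differs : ∀ p → ParentOK L₁ p S → sameT p S ≡ false
    differs nothing _ = refl
    differs (just P) (P∈L₁ , S⊂P , _) = ≢⇒≡ᵇ≡false _ _ same-terminals-absurd
      where
      same-terminals-absurd : ¬ ∣ P ∩ T ∣ ≡ ∣ S ∩ T ∣
      same-terminals-absurd ∣P∩T∣≡∣S∩T∣ with pruned-∈⁻ pruned₁ P∈L₁
      ... | P∈L , extremeIn with extremeIn-⊆-supreme laminar cuts complete P∈L extremeIn
      ...   | S′ , sup′ , P⊆S′ , P∩T≡S′∩T = p⊂q⇒q⊈p S⊂P (subst (P ⊆_) (sym S≡S′) P⊆S′)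
        where
        S∩T≡P∩T : S ∩ T ≡ P ∩ T
        S∩T≡P∩T = ⊆∧∣p∣≡∣q∣⇒≡ (∩-monoˡ-⊆ T (p⊂q⇒p⊆q S⊂P)) (sym ∣P∩T∣≡∣S∩T∣)
        S≡S′ : S ≡ S′
        S≡S′ = supreme-unique sup sup′ (trans S∩T≡P∩T P∩T≡S′∩T)

  ∈process⇒supreme : ∀ S → S ∈ₗ nodesF (process F) → Supreme S
  ∈process⇒supreme S S∈ with pruned-∈⁻ pruned₂ S∈
  ... | S∈L₁ , p , S-parent , differs with pruned-∈⁻ pruned₁ S∈L₁
  ...   | S∈L , extremeIn with extremeIn-⊆-supreme laminar cuts complete S∈L extremeIn
  ...     | S′ , sup′ , S⊆S′ , S∩T≡S′∩T with ⊆⇒⊂⊎≡ S⊆S′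
  ...       | inj₂ S≡S′ = subst Supreme (sym S≡S′) sup′
  ...       | inj₁ S⊂S′ = ⊥-elim (parent-absurd p S-parent differs)
    where
    parent-absurd : ∀ p → ParentOK L₁ p S → sameT p S ≡ false → ⊥
    parent-absurd nothing root _ = root S′ (supreme∈L₁ sup′) S⊂S′
    parent-absurd (just P) P-parent differs = subst Bool.T differs (≡⇒≡ᵇ _ _ (cong ∣_∣ P∩T≡S∩T))
      where
      P⊆S′ : P ⊆ S′
      P⊆S′ = parent-⊆ laminar₁ P-parent (nonempty S∈L) (supreme∈L₁ sup′) S⊂S′
      P∩T≡S∩T : P ∩ T ≡ S ∩ T
      P∩T≡S∩T =
        trans (∩-sandwich T (p⊂q⇒p⊆q (proj₁ (proj₂ P-parent))) P⊆S′ S∩T≡S′∩T) (sym S∩T≡S′∩T)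

mainTheorem14 : ∀ {n} (G : PerturbedGraph n) (F : Forest (Subset n))
    → RepresentsLaminar F
    → All (PerturbedGraph.SteinerCut G) (nodesF F)
    → (∀ S → PerturbedGraph.Supreme G S → S ∈ₗ nodesF F)
    → RepresentsLaminar (Traversals.process G F)
      × (∀ S → (S ∈ₗ nodesF (Traversals.process G F)) ⇔ PerturbedGraph.Supreme G S)
mainTheorem14 G F represents cuts complete =
  process-represents , λ S → mk⇔ (∈process⇒supreme S) (supreme⇒∈process S)
  where open Correctness G F represents cuts complete
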